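{- Let $b$ be a positive integer. A $b$-colored partition of $n$ is a finite multiset of colored parts $r_c$, with $r\ge1$ and $c\in\{1,\dots,b\}$, whose sizes $r$ (counted with multiplicity) sum to $n$. Fix a positive integer $k$. Let $F_k(n)$ be the total number of parts of size $k$ (of any color, counted with multiplicity) in all $b$-colored partitions of $n$. For a $b$-colored partition $\pi$, let $H_k(\pi)=\sum r$, the sum over the distinct colored parts $r_c$ occurring in $\pi$ with $k\mid r$ (each distinct colored part $r_c$ counted once regardless of its multiplicity, contributing its size $r$), and let $H_k(n)=\sum_\pi H_k(\pi)$ over all $b$-colored partitions $\pi$ of $n$, with $H_k(m)=0$ for $m<0$. Then for all positive integers $n$, $$kF_k(n)=H_k(n)-H_k(n-k).$$
   Context: For example, with $b=2$, the partition $3_1+3_2+6_1+6_1+6_1+6_2$ contributes $3+3+6+6=18$ to $H_3(30)$. -}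

module Defs where

open import Data.Nat using (ℕ; zero; suc; _+_; _*_; _≟_)
open import Data.Nat.Divisibility using (_∣?_)
open import Data.Fin using (Fin)
open import Data.Vec using (Vec; []; _∷_; lookup)
open import Data.List using (List; []; _∷_; map; concatMap; filter; upTo)
open import Data.Nat.ListAction using (sum)
open import Data.Integer using (ℤ; +_; -[1+_])
open import Relation.Nullary using (does)
open import Data.Bool using (if_then_else_)

-- A b-colored partition of n is a finite multiset of colored parts r_c
-- (1 ≤ r, c ∈ Fin b) whose sizes sum to n.  Since every part has size
-- ≤ n and multiplicity ≤ n, such a multiset is exactly encoded by its
-- multiplicity table  m : Vec (Vec ℕ b) n, where  lookup (lookup m i) c
-- is the multiplicity of the colored part (i+1)_c, subject to
-- Σ_{i,c} (i+1) * m[i][c] ≡ n.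

vecsUpTo : (len bound : ℕ) → List (Vec ℕ len)
vecsUpTo zero    bound = [] ∷ []
vecsUpTo (suc l) bound =
  concatMap (λ x → map (x ∷_) (vecsUpTo l bound)) (upTo (suc bound))

tables : (b s bound : ℕ) → List (Vec (Vec ℕ b) s)
tables b zero    bound = [] ∷ []
tables b (suc s) bound =
  concatMap (λ row → map (row ∷_) (tables b s bound)) (vecsUpTo b bound)

vsum : ∀ {l} → Vec ℕ l → ℕ
vsum []       = 0
vsum (x ∷ xs) = x + vsum xs

tsum : ∀ {b s} → (ℕ → ℕ → ℕ) → ℕ → Vec (Vec ℕ b) s → ℕ
tsum f off []         = 0
tsum f off (row ∷ rs) =
  vsum (Data.Vec.map (f (suc off)) row) + tsum f (suc off) rs

weight : ∀ {b s} → Vec (Vec ℕ b) s → ℕ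
weight = tsum (λ r m → r * m) 0

ColPartitions : (b n : ℕ) → List (Vec (Vec ℕ b) n)
ColPartitions b n = filter (λ t → weight t ≟ n) (tables b n n)

partsOfSize : ∀ {b s} → ℕ → Vec (Vec ℕ b) s → ℕ
partsOfSize k = tsum (λ r m → if does (r ≟ k) then m else 0) 0

Hπ : ∀ {b s} → ℕ → Vec (Vec ℕ b) s → ℕ
Hπ k = tsum (λ r m → if does (m ≟ 0) then 0
                     else (if does (k ∣? r) then r else 0)) 0

F : (b k n : ℕ) → ℕ
F b k n = sum (map (partsOfSize k) (ColPartitions b n))

H : (b k n : ℕ) → ℕ
H b k n = sum (map (Hπ k) (ColPartitions b n))

Hℤ : (b k : ℕ) → ℤ → ℕ
Hℤ b k (+ m)      = H b k m
Hℤ b k -[1+ m ]   = 0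

-- Let p(y) be the number of b-coloured partitions of y.  The partitions of n containing a given
-- coloured part s_c are counted by p(n − s), so H_k(n) = b Σ_{k ∣ s} s p(n − s); removing one part
-- of size k gives F_k(n) = b p(n − k) + F_k(n − k), i.e. F_k(n) = b Σ_{k ∣ s} p(n − s).  Shifting
-- s ↦ s + k in H_k(n − k) and using (s + k) − s = k then leaves H_k(n) − H_k(n − k) = k F_k(n).
-- Since partitions are enumerated as multiplicity tables of size n, the sums over partitions are
-- first rewritten as sums over the multiplicity of each coloured part, and p(y) is shown not to
-- depend on the size of the tables.
module Submission where

open import Defs

-- Kept apart so that ℕ's _*_ is not in scope in the statement, whose _*_ is that of ℤ.
module Recurrence where
  open import Data.Nat using (ℕ; NonZero; >-nonZero; >-nonZero⁻¹; zero; suc; _+_; _*_; _∸_; _≤_; _<_; _≤?_; _≟_; z≤n; s≤s)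
  open import Data.Nat.Properties
  open import Data.Nat.Divisibility using (_∣?_; ∣-refl; ∣m∣n⇒∣m+n; ∣m+n∣m⇒∣n; >⇒∤)
  open import Data.Nat.ListAction using (sum)
  open import Data.Nat.Induction using (<-rec)
  open import Algebra.Properties.CommutativeSemigroup +-commutativeSemigroup using (interchange)
  open import Algebra.Properties.CommutativeSemigroup *-commutativeSemigroup using (x∙yz≈y∙xz)
  open import Data.Bool using (true; false; if_then_else_)
  open import Data.List using (List; []; _∷_; _++_; map; concatMap; filter; applyUpTo; replicate)
  open import Data.List.Properties using (++-assoc)
  open import Data.List.Relation.Unary.All as All using (All; []; _∷_)
  open import Data.List.Relation.Unary.All.Properties using (++⁺; replicate⁺)
  open import Data.Vec using (Vec; _∷_)
  import Data.Vec as Vec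
  open import Function using (_∘_; id)
  open import Relation.Nullary using (Dec; yes; no; does; ¬_; contradiction)
  open import Relation.Unary using (Decidable)
  open import Relation.Binary.PropositionalEquality
  open ≡-Reasoning

  ∑∈ : {A : Set} → List A → (A → ℕ) → ℕ
  ∑∈ xs f = sum (map f xs)

  syntax ∑∈ xs (λ x → e) = ∑[ x ∈ xs ] e

  ∑< : ℕ → (ℕ → ℕ) → ℕ
  ∑< zero    f = 0
  ∑< (suc n) f = f 0 + ∑< n (f ∘ suc)

  syntax ∑< n (λ i → e) = ∑[ i < n ] e

  module _ {A : Set} where

    ∑∈-cong : ∀ xs {f g : A → ℕ} → (∀ x → f x ≡ g x) → ∑∈ xs f ≡ ∑∈ xs g
    ∑∈-cong []       f≗g = refl
    ∑∈-cong (x ∷ xs) f≗g = cong₂ _+_ (f≗g x) (∑∈-cong xs f≗g)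

    ∑∈-zero : (xs : List A) → ∑[ x ∈ xs ] 0 ≡ 0
    ∑∈-zero []       = refl
    ∑∈-zero (x ∷ xs) = ∑∈-zero xs

    ∑∈-++ : ∀ xs ys (f : A → ℕ) → ∑∈ (xs ++ ys) f ≡ ∑∈ xs f + ∑∈ ys f
    ∑∈-++ []       ys f = refl
    ∑∈-++ (x ∷ xs) ys f = trans (cong (f x +_) (∑∈-++ xs ys f)) (sym (+-assoc (f x) _ _))

    ∑∈-+ : ∀ xs (f g : A → ℕ) → ∑[ x ∈ xs ] (f x + g x) ≡ ∑∈ xs f + ∑∈ xs g
    ∑∈-+ []       f g = refl
    ∑∈-+ (x ∷ xs) f g = trans (cong (f x + g x +_) (∑∈-+ xs f g)) (interchange (f x) (g x) _ _)

    ∑∈-*ˡ : ∀ xs c (f : A → ℕ) → ∑[ x ∈ xs ] (c * f x) ≡ c * ∑∈ xs f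
    ∑∈-*ˡ []       c f = sym (*-zeroʳ c)
    ∑∈-*ˡ (x ∷ xs) c f = trans (cong (c * f x +_) (∑∈-*ˡ xs c f)) (sym (*-distribˡ-+ c (f x) _))

    ∑∈-replicate : ∀ n (x : A) f → ∑∈ (replicate n x) f ≡ n * f x
    ∑∈-replicate zero    x f = refl
    ∑∈-replicate (suc n) x f = cong (f x +_) (∑∈-replicate n x f)

  module _ {A B : Set} where

    ∑∈-map : ∀ xs (h : A → B) f → ∑∈ (map h xs) f ≡ ∑∈ xs (f ∘ h)
    ∑∈-map []       h f = refl
    ∑∈-map (x ∷ xs) h f = cong (f (h x) +_) (∑∈-map xs h f)

    ∑∈-concatMap : ∀ xs (q : A → List B) f → ∑∈ (concatMap q xs) f ≡ ∑[ x ∈ xs ] ∑∈ (q x) f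
    ∑∈-concatMap []       q f = refl
    ∑∈-concatMap (x ∷ xs) q f =
      trans (∑∈-++ (q x) (concatMap q xs) f) (cong (∑∈ (q x) f +_) (∑∈-concatMap xs q f))

  module _ {A B C : Set} where

    ∑∈-product : ∀ xs ys (_⊗_ : A → B → C) f →
                 ∑∈ (concatMap (λ x → map (x ⊗_) ys) xs) f ≡ ∑[ x ∈ xs ] ∑[ y ∈ ys ] f (x ⊗ y)
    ∑∈-product xs ys _⊗_ f =
      trans (∑∈-concatMap xs _ f) (∑∈-cong xs (λ x → ∑∈-map ys (x ⊗_) f))

  ∑∈-applyUpTo : ∀ n (g f : ℕ → ℕ) → ∑∈ (applyUpTo g n) f ≡ ∑[ i < n ] f (g i)
  ∑∈-applyUpTo zero    g f = refl
  ∑∈-applyUpTo (suc n) g f = cong (f (g 0) +_) (∑∈-applyUpTo n (g ∘ suc) f)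

  ∑<-cong : ∀ n {f g : ℕ → ℕ} → (∀ i → f i ≡ g i) → ∑< n f ≡ ∑< n g
  ∑<-cong zero    f≗g = refl
  ∑<-cong (suc n) f≗g = cong₂ _+_ (f≗g 0) (∑<-cong n (f≗g ∘ suc))

  ∑<-cong-< : ∀ n {f g : ℕ → ℕ} → (∀ i → i < n → f i ≡ g i) → ∑< n f ≡ ∑< n g
  ∑<-cong-< zero    f≗g = refl
  ∑<-cong-< (suc n) f≗g = cong₂ _+_ (f≗g 0 (s≤s z≤n)) (∑<-cong-< n (λ i i<n → f≗g (suc i) (s≤s i<n)))

  ∑<-+ : ∀ n (f g : ℕ → ℕ) → ∑[ i < n ] (f i + g i) ≡ ∑< n f + ∑< n g
  ∑<-+ zero    f g = refl
  ∑<-+ (suc n) f g = trans (cong (f 0 + g 0 +_) (∑<-+ n _ _)) (interchange (f 0) (g 0) _ _)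

  ∑<-*ˡ : ∀ n c (f : ℕ → ℕ) → ∑[ i < n ] (c * f i) ≡ c * ∑< n f
  ∑<-*ˡ zero    c f = sym (*-zeroʳ c)
  ∑<-*ˡ (suc n) c f = trans (cong (c * f 0 +_) (∑<-*ˡ n c _)) (sym (*-distribˡ-+ c (f 0) _))

  ∑<-zero : ∀ n (f : ℕ → ℕ) → (∀ i → i < n → f i ≡ 0) → ∑< n f ≡ 0
  ∑<-zero zero    f f≡0 = refl
  ∑<-zero (suc n) f f≡0 = cong₂ _+_ (f≡0 0 (s≤s z≤n)) (∑<-zero n _ (λ i i<n → f≡0 (suc i) (s≤s i<n)))

  ∑<-split : ∀ m n (f : ℕ → ℕ) → ∑< (m + n) f ≡ ∑< m f + ∑[ i < n ] f (m + i)
  ∑<-split zero    n f = refl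
  ∑<-split (suc m) n f = trans (cong (f 0 +_) (∑<-split m n _)) (sym (+-assoc (f 0) _ _))

  ∑<-suc : ∀ n (f : ℕ → ℕ) → ∑< (suc n) f ≡ ∑< n f + f n
  ∑<-suc zero    f = +-comm (f 0) 0
  ∑<-suc (suc n) f = trans (cong (f 0 +_) (∑<-suc n _)) (sym (+-assoc (f 0) _ _))

  ∑<-extend : ∀ m n (f : ℕ → ℕ) → m ≤ n → (∀ i → m ≤ i → f i ≡ 0) → ∑< n f ≡ ∑< m f
  ∑<-extend m n f m≤n f≡0 = begin
    ∑< n f                               ≡⟨ cong (λ l → ∑< l f) (sym (m+[n∸m]≡n m≤n)) ⟩
    ∑< (m + (n ∸ m)) f                   ≡⟨ ∑<-split m (n ∸ m) f ⟩
    ∑< m f + ∑[ i < n ∸ m ] f (m + i)    ≡⟨ cong (∑< m f +_) (∑<-zero (n ∸ m) _ (λ i _ → f≡0 (m + i) (m≤m+n m i))) ⟩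
    ∑< m f + 0                           ≡⟨ +-identityʳ _ ⟩
    ∑< m f                               ∎

  ∑<-comm-∑∈ : {A : Set} → ∀ n (xs : List A) (f : ℕ → A → ℕ) →
               ∑[ i < n ] ∑[ x ∈ xs ] f i x ≡ ∑[ x ∈ xs ] ∑[ i < n ] f i x
  ∑<-comm-∑∈ zero    xs f = sym (∑∈-zero xs)
  ∑<-comm-∑∈ (suc n) xs f = trans (cong (∑∈ xs (f 0) +_) (∑<-comm-∑∈ n xs (f ∘ suc))) (sym (∑∈-+ xs _ _))

  when : ∀ {p} {P : Set p} → Dec P → ℕ → ℕ
  when P? x = if does P? then x else 0

  module _ {p} {P : Set p} where

    when-yes : ∀ (P? : Dec P) x → P → when P? x ≡ x
    when-yes (yes _) x _  = refl
    when-yes (no ¬p) x p = contradiction p ¬p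

    when-no : ∀ (P? : Dec P) x → ¬ P → when P? x ≡ 0
    when-no (yes p) x ¬p = contradiction p ¬p
    when-no (no _)  x _  = refl

    when-zero : ∀ (P? : Dec P) → when P? 0 ≡ 0
    when-zero (yes _) = refl
    when-zero (no _)  = refl

    when-⇔ : ∀ {q} {Q : Set q} (P? : Dec P) (Q? : Dec Q) x → (P → Q) → (Q → P) → when P? x ≡ when Q? x
    when-⇔ (yes p) (yes q) x P→Q Q→P = refl
    when-⇔ (yes p) (no ¬q) x P→Q Q→P = contradiction (P→Q p) ¬q
    when-⇔ (no ¬p) (yes q) x P→Q Q→P = contradiction (Q→P q) ¬p
    when-⇔ (no ¬p) (no ¬q) x P→Q Q→P = refl

    when-+ : ∀ (P? : Dec P) x y → when P? (x + y) ≡ when P? x + when P? y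
    when-+ (yes _) x y = refl
    when-+ (no _)  x y = refl

    when-*ˡ : ∀ (P? : Dec P) c x → when P? (c * x) ≡ c * when P? x
    when-*ˡ (yes _) c x = refl
    when-*ˡ (no _)  c x = sym (*-zeroʳ c)

    when-affine : ∀ (P? : Dec P) c x → when P? (c + x) ≡ c * when P? 1 + when P? x
    when-affine (yes _) c x = cong (_+ x) (sym (*-identityʳ c))
    when-affine (no _)  c x = sym (cong (_+ 0) (*-zeroʳ c))

    ∑<-when : ∀ (P? : Dec P) n (f : ℕ → ℕ) → ∑[ i < n ] when P? (f i) ≡ when P? (∑< n f)
    ∑<-when (yes _) n f = refl
    ∑<-when (no _)  n f = ∑<-zero n _ (λ _ _ → refl)

    ∑∈-when : {A : Set} (P? : Dec P) (xs : List A) (f : A → ℕ) →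
              ∑[ x ∈ xs ] when P? (f x) ≡ when P? (∑∈ xs f)
    ∑∈-when (yes _) xs f = refl
    ∑∈-when (no _)  xs f = ∑∈-zero xs

  ∑∈-filter : {A : Set} {P : A → Set} (P? : Decidable P) → ∀ xs (f : A → ℕ) →
              ∑∈ (filter P? xs) f ≡ ∑[ x ∈ xs ] when (P? x) (f x)
  ∑∈-filter P? []       f = refl
  ∑∈-filter P? (x ∷ xs) f with does (P? x)
  ... | true  = cong (f x +_) (∑∈-filter P? xs f)
  ... | false = ∑∈-filter P? xs f

  ∑<-when-≟ : ∀ n k x → k < n → ∑[ i < n ] when (i ≟ k) x ≡ x
  ∑<-when-≟ (suc n) zero    x _         = trans (cong (x +_) (∑<-zero n _ (λ _ _ → refl))) (+-identityʳ x)
  ∑<-when-≟ (suc n) (suc k) x (s≤s k<n) = ∑<-when-≟ n k x k<n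

  -- Multiplication of the generating function of f by xᵃ.
  shift : ℕ → (ℕ → ℕ) → ℕ → ℕ
  shift a f n = when (a ≤? n) (f (n ∸ a))

  shift-≤ : ∀ {a n} f → a ≤ n → shift a f n ≡ f (n ∸ a)
  shift-≤ {a} {n} f a≤n = when-yes (a ≤? n) _ a≤n

  shift-> : ∀ {a n} f → n < a → shift a f n ≡ 0
  shift-> {a} {n} f n<a = when-no (a ≤? n) _ (<⇒≱ n<a)

  shift-cong : ∀ a {f g} n → (∀ m → f m ≡ g m) → shift a f n ≡ shift a g n
  shift-cong a n f≗g = cong (when (a ≤? n)) (f≗g (n ∸ a))

  shift-shift : ∀ a c f n → shift a (shift c f) n ≡ shift (a + c) f n
  shift-shift a c f n with a ≤? n
  ... | no a≰n = trans (shift-> (shift c f) a>n) (sym (shift-> f (<-≤-trans a>n (m≤m+n a c))))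
    where a>n = ≰⇒> a≰n
  ... | yes a≤n with c ≤? n ∸ a
  ...   | yes c≤n∸a = begin
    shift a (shift c f) n   ≡⟨ shift-≤ (shift c f) a≤n ⟩
    shift c f (n ∸ a)       ≡⟨ shift-≤ f c≤n∸a ⟩
    f (n ∸ a ∸ c)           ≡⟨ cong f (∸-+-assoc n a c) ⟩
    f (n ∸ (a + c))         ≡⟨ shift-≤ f (subst (a + c ≤_) (m+[n∸m]≡n a≤n) (+-monoʳ-≤ a c≤n∸a)) ⟨
    shift (a + c) f n       ∎
  ...   | no c≰n∸a = begin
    shift a (shift c f) n   ≡⟨ shift-≤ (shift c f) a≤n ⟩
    shift c f (n ∸ a)       ≡⟨ shift-> f (≰⇒> c≰n∸a) ⟩
    0                       ≡⟨ shift-> f (≰⇒> (λ a+c≤n → c≰n∸a (subst (_≤ n ∸ a) (m+n∸m≡n a c) (∸-monoˡ-≤ a a+c≤n)))) ⟨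
    shift (a + c) f n       ∎

  shift-comm : ∀ a c f n → shift a (shift c f) n ≡ shift c (shift a f) n
  shift-comm a c f n = begin
    shift a (shift c f) n   ≡⟨ shift-shift a c f n ⟩
    shift (a + c) f n       ≡⟨ cong (λ l → shift l f n) (+-comm a c) ⟩
    shift (c + a) f n       ≡⟨ shift-shift c a f n ⟨
    shift c (shift a f) n   ∎

  when-≟-shift : ∀ a w n x → when (a + w ≟ n) x ≡ shift a (λ n′ → when (w ≟ n′) x) n
  when-≟-shift a w n x with a ≤? n
  ... | no a≰n = trans (when-no (a + w ≟ n) x (λ a+w≡n → a≰n (subst (a ≤_) a+w≡n (m≤m+n a w))))
                       (sym (shift-> (λ n′ → when (w ≟ n′) x) (≰⇒> a≰n)))
  ... | yes a≤n = trans
    (when-⇔ (a + w ≟ n) (w ≟ n ∸ a) x (λ a+w≡n → trans (sym (m+n∸m≡n a w)) (cong (_∸ a) a+w≡n))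
                                      (λ w≡n∸a → trans (cong (a +_) w≡n∸a) (m+[n∸m]≡n a≤n)))
    (sym (shift-≤ (λ n′ → when (w ≟ n′) x) a≤n))

  ∑∈-shift : {A : Set} (xs : List A) → ∀ a (f : A → ℕ → ℕ) n →
             ∑[ x ∈ xs ] shift a (f x) n ≡ shift a (λ n′ → ∑[ x ∈ xs ] f x n′) n
  ∑∈-shift xs a f n = ∑∈-when (a ≤? n) xs (λ x → f x (n ∸ a))

  ∑<-shift : ∀ m a (f : ℕ → ℕ → ℕ) n → ∑[ i < m ] shift a (f i) n ≡ shift a (λ n′ → ∑[ i < m ] f i n′) n
  ∑<-shift m a f n = ∑<-when (a ≤? n) m (λ i → f i (n ∸ a))

  shift-*ˡ : ∀ a c f n → shift a (λ n′ → c * f n′) n ≡ c * shift a f n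
  shift-*ˡ a c f n = when-*ˡ (a ≤? n) c (f (n ∸ a))

  shift-+ : ∀ a f g n → shift a (λ n′ → f n′ + g n′) n ≡ shift a f n + shift a g n
  shift-+ a f g n = when-+ (a ≤? n) (f (n ∸ a)) (g (n ∸ a))

  shift-split : ∀ a c d (f g : ℕ → ℕ) n →
                shift a (λ n′ → (c + d) * f n′ + g n′) n ≡ c * shift a f n + shift a (λ n′ → d * f n′ + g n′) n
  shift-split a c d f g n = begin
    shift a (λ n′ → (c + d) * f n′ + g n′) n       ≡⟨ shift-cong a n (λ n′ → regroup (f n′) (g n′)) ⟩
    shift a (λ n′ → c * f n′ + (d * f n′ + g n′)) n ≡⟨ shift-+ a (λ n′ → c * f n′) (λ n′ → d * f n′ + g n′) n ⟩
    shift a (λ n′ → c * f n′) n + shift a (λ n′ → d * f n′ + g n′) n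
                                                    ≡⟨ cong (_+ shift a (λ n′ → d * f n′ + g n′) n) (shift-*ˡ a c f n) ⟩
    c * shift a f n + shift a (λ n′ → d * f n′ + g n′) n ∎
    where
    regroup : ∀ x y → (c + d) * x + y ≡ c * x + (d * x + y)
    regroup x y = trans (cong (_+ y) (*-distribʳ-+ x c d)) (+-assoc (c * x) (d * x) y)

  rowSum : ∀ {l} → (ℕ → ℕ) → Vec ℕ l → ℕ
  rowSum h v = vsum (Vec.map h v)

  -- For a list cs of part sizes (one entry per coloured part), count B cs n is the number of ways to
  -- give each entry a multiplicity ≤ B with total size n, and total B g cs n sums Σ g s mₛ over them.
  count : ℕ → List ℕ → ℕ → ℕ
  count B []       n = when (0 ≟ n) 1
  count B (s ∷ cs) n = ∑[ m < suc B ] shift (s * m) (count B cs) n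

  total : ℕ → (ℕ → ℕ → ℕ) → List ℕ → ℕ → ℕ
  total B g []       n = 0
  total B g (s ∷ cs) n = ∑[ m < suc B ] shift (s * m) (λ n′ → g s m * count B cs n′ + total B g cs n′) n

  total-∷ : ∀ B g t cs n → total B g (t ∷ cs) n
            ≡ ∑[ m < suc B ] shift (t * m) (λ n′ → g t m * count B cs n′) n + ∑[ m < suc B ] shift (t * m) (total B g cs) n
  total-∷ B g t cs n = trans
    (∑<-cong (suc B) (λ m → shift-+ (t * m) (λ n′ → g t m * count B cs n′) (total B g cs) n))
    (∑<-+ (suc B) (λ m → shift (t * m) (λ n′ → g t m * count B cs n′) n) (λ m → shift (t * m) (total B g cs) n))

  -- The sizes off + 1, …, off + s, each once per colour: the entries of rows off + 1, …, off + s of a table.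
  colouredParts : ℕ → ℕ → ℕ → List ℕ
  colouredParts b zero    off = []
  colouredParts b (suc s) off = replicate b (suc off) ++ colouredParts b s (suc off)

  module _ (B : ℕ) where

    ∑∈-vecsUpTo : ∀ l (f : Vec ℕ (suc l) → ℕ) →
                  ∑∈ (vecsUpTo (suc l) B) f ≡ ∑[ x < suc B ] ∑[ v ∈ vecsUpTo l B ] f (x ∷ v)
    ∑∈-vecsUpTo l f = trans (∑∈-product (applyUpTo id (suc B)) (vecsUpTo l B) _∷_ f) (∑∈-applyUpTo (suc B) id _)

    count-row : ∀ l r cs n →
                ∑[ v ∈ vecsUpTo l B ] shift (rowSum (r *_) v) (count B cs) n ≡ count B (replicate l r ++ cs) n
    count-row zero    r cs n = +-identityʳ _
    count-row (suc l) r cs n = trans (∑∈-vecsUpTo l _) (∑<-cong (suc B) λ x → begin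
      ∑[ v ∈ vecsUpTo l B ] shift (r * x + rowSum (r *_) v) (count B cs) n
        ≡⟨ ∑∈-cong (vecsUpTo l B) (λ v → shift-shift (r * x) (rowSum (r *_) v) (count B cs) n) ⟨
      ∑[ v ∈ vecsUpTo l B ] shift (r * x) (shift (rowSum (r *_) v) (count B cs)) n
        ≡⟨ ∑∈-shift (vecsUpTo l B) (r * x) (λ v → shift (rowSum (r *_) v) (count B cs)) n ⟩
      shift (r * x) (λ n′ → ∑[ v ∈ vecsUpTo l B ] shift (rowSum (r *_) v) (count B cs) n′) n
        ≡⟨ shift-cong (r * x) n (count-row l r cs) ⟩
      shift (r * x) (count B (replicate l r ++ cs)) n ∎)

    total-row : ∀ g l r cs n →
                ∑[ v ∈ vecsUpTo l B ] shift (rowSum (r *_) v) (λ n′ → rowSum (g r) v * count B cs n′ + total B g cs n′) n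
                ≡ total B g (replicate l r ++ cs) n
    total-row g zero    r cs n = +-identityʳ _
    total-row g (suc l) r cs n = trans (∑∈-vecsUpTo l _) (∑<-cong (suc B) λ x → begin
      ∑[ v ∈ V ] shift (r * x + w v) (φ (g r x + σ v)) n
        ≡⟨ ∑∈-cong V (λ v → shift-shift (r * x) (w v) (φ (g r x + σ v)) n) ⟨
      ∑[ v ∈ V ] shift (r * x) (shift (w v) (φ (g r x + σ v))) n
        ≡⟨ ∑∈-shift V (r * x) (λ v → shift (w v) (φ (g r x + σ v))) n ⟩
      shift (r * x) (λ n′ → ∑[ v ∈ V ] shift (w v) (φ (g r x + σ v)) n′) n
        ≡⟨ shift-cong (r * x) n (λ n′ → begin
             ∑[ v ∈ V ] shift (w v) (φ (g r x + σ v)) n′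
               ≡⟨ ∑∈-cong V (λ v → shift-split (w v) (g r x) (σ v) (count B cs) (total B g cs) n′) ⟩
             ∑[ v ∈ V ] (g r x * shift (w v) (count B cs) n′ + shift (w v) (φ (σ v)) n′)
               ≡⟨ ∑∈-+ V _ _ ⟩
             ∑[ v ∈ V ] (g r x * shift (w v) (count B cs) n′) + ∑[ v ∈ V ] shift (w v) (φ (σ v)) n′
               ≡⟨ cong₂ _+_ (∑∈-*ˡ V (g r x) _) refl ⟩
             g r x * ∑[ v ∈ V ] shift (w v) (count B cs) n′ + ∑[ v ∈ V ] shift (w v) (φ (σ v)) n′
               ≡⟨ cong₂ (λ c t → g r x * c + t) (count-row l r cs n′) (total-row g l r cs n′) ⟩
             g r x * count B (replicate l r ++ cs) n′ + total B g (replicate l r ++ cs) n′ ∎) ⟩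
      shift (r * x) (λ n′ → g r x * count B (replicate l r ++ cs) n′ + total B g (replicate l r ++ cs) n′) n ∎)
      where
      V = vecsUpTo l B
      w σ : Vec ℕ l → ℕ
      w = rowSum (r *_)
      σ = rowSum (g r)
      φ : ℕ → ℕ → ℕ
      φ c n′ = c * count B cs n′ + total B g cs n′

    weightFrom : ∀ {b s} → ℕ → Vec (Vec ℕ b) s → ℕ
    weightFrom = tsum (λ r m → r * m)

    count-tables : ∀ b s off n →
                   ∑[ t ∈ tables b s B ] when (weightFrom off t ≟ n) 1 ≡ count B (colouredParts b s off) n
    count-tables b zero    off n = +-identityʳ _
    count-tables b (suc s) off n = begin
      ∑[ t ∈ tables b (suc s) B ] when (weightFrom off t ≟ n) 1
        ≡⟨ ∑∈-product (vecsUpTo b B) T _∷_ _ ⟩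
      ∑[ row ∈ vecsUpTo b B ] ∑[ t ∈ T ] when (w row + weightFrom (suc off) t ≟ n) 1
        ≡⟨ ∑∈-cong (vecsUpTo b B) (λ row → ∑∈-cong T (λ t → when-≟-shift (w row) (weightFrom (suc off) t) n 1)) ⟩
      ∑[ row ∈ vecsUpTo b B ] ∑[ t ∈ T ] shift (w row) (λ n′ → when (weightFrom (suc off) t ≟ n′) 1) n
        ≡⟨ ∑∈-cong (vecsUpTo b B) (λ row → ∑∈-shift T (w row) (λ t n′ → when (weightFrom (suc off) t ≟ n′) 1) n) ⟩
      ∑[ row ∈ vecsUpTo b B ] shift (w row) (λ n′ → ∑[ t ∈ T ] when (weightFrom (suc off) t ≟ n′) 1) n
        ≡⟨ ∑∈-cong (vecsUpTo b B) (λ row → shift-cong (w row) n (count-tables b s (suc off))) ⟩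
      ∑[ row ∈ vecsUpTo b B ] shift (w row) (count B (colouredParts b s (suc off))) n
        ≡⟨ count-row b (suc off) (colouredParts b s (suc off)) n ⟩
      count B (colouredParts b (suc s) off) n ∎
      where
      T = tables b s B
      w : Vec ℕ b → ℕ
      w = rowSum (suc off *_)

    total-tables : ∀ g b s off n →
                   ∑[ t ∈ tables b s B ] when (weightFrom off t ≟ n) (tsum g off t) ≡ total B g (colouredParts b s off) n
    total-tables g b zero    off n = trans (+-identityʳ _) (when-zero (0 ≟ n))
    total-tables g b (suc s) off n = begin
      ∑[ t ∈ tables b (suc s) B ] when (weightFrom off t ≟ n) (tsum g off t)
        ≡⟨ ∑∈-product (vecsUpTo b B) T _∷_ _ ⟩
      ∑[ row ∈ vecsUpTo b B ] ∑[ t ∈ T ] when (w row + weightFrom (suc off) t ≟ n) (σ row + tsum g (suc off) t)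
        ≡⟨ ∑∈-cong (vecsUpTo b B) (λ row → ∑∈-cong T (λ t → when-≟-shift (w row) (weightFrom (suc off) t) n _)) ⟩
      ∑[ row ∈ vecsUpTo b B ] ∑[ t ∈ T ] shift (w row) (φ (σ row) t) n
        ≡⟨ ∑∈-cong (vecsUpTo b B) (λ row → ∑∈-shift T (w row) (φ (σ row)) n) ⟩
      ∑[ row ∈ vecsUpTo b B ] shift (w row) (λ n′ → ∑[ t ∈ T ] φ (σ row) t n′) n
        ≡⟨ ∑∈-cong (vecsUpTo b B) (λ row → shift-cong (w row) n (split (σ row))) ⟩
      ∑[ row ∈ vecsUpTo b B ] shift (w row) (λ n′ → σ row * count B cs n′ + total B g cs n′) n
        ≡⟨ total-row g b (suc off) cs n ⟩
      total B g (colouredParts b (suc s) off) n ∎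
      where
      T = tables b s B
      cs = colouredParts b s (suc off)
      w σ : Vec ℕ b → ℕ
      w = rowSum (suc off *_)
      σ = rowSum (g (suc off))
      φ : ℕ → Vec (Vec ℕ b) s → ℕ → ℕ
      φ c t n′ = when (weightFrom (suc off) t ≟ n′) (c + tsum g (suc off) t)
      split : ∀ c n′ → ∑[ t ∈ T ] φ c t n′ ≡ c * count B cs n′ + total B g cs n′
      split c n′ = begin
        ∑[ t ∈ T ] φ c t n′
          ≡⟨ ∑∈-cong T (λ t → when-affine (weightFrom (suc off) t ≟ n′) c _) ⟩
        ∑[ t ∈ T ] (c * when (weightFrom (suc off) t ≟ n′) 1 + when (weightFrom (suc off) t ≟ n′) (tsum g (suc off) t))
          ≡⟨ ∑∈-+ T _ _ ⟩
        ∑[ t ∈ T ] (c * when (weightFrom (suc off) t ≟ n′) 1) + ∑[ t ∈ T ] when (weightFrom (suc off) t ≟ n′) (tsum g (suc off) t)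
          ≡⟨ cong₂ _+_ (∑∈-*ˡ T c _) refl ⟩
        c * ∑[ t ∈ T ] when (weightFrom (suc off) t ≟ n′) 1 + ∑[ t ∈ T ] when (weightFrom (suc off) t ≟ n′) (tsum g (suc off) t)
          ≡⟨ cong₂ (λ x y → c * x + y) (count-tables b s (suc off) n′) (total-tables g b s (suc off) n′) ⟩
        c * count B cs n′ + total B g cs n′ ∎

  kMultiplicity : ℕ → ℕ → ℕ → ℕ
  kMultiplicity k r m = when (r ≟ k) m

  isMultiple ifMultiple : ℕ → ℕ → ℕ
  isMultiple k r = when (k ∣? r) 1
  ifMultiple k r = when (k ∣? r) r

  presentMultiple : ℕ → ℕ → ℕ → ℕ
  presentMultiple k r m = if does (m ≟ 0) then 0 else ifMultiple k r

  F-total : ∀ b k n → F b k n ≡ total n (kMultiplicity k) (colouredParts b n 0) n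
  F-total b k n = trans (∑∈-filter (λ t → weight t ≟ n) (tables b n n) (partsOfSize k)) (total-tables n _ b n 0 n)

  H-total : ∀ b k n → H b k n ≡ total n (presentMultiple k) (colouredParts b n 0) n
  H-total b k n = trans (∑∈-filter (λ t → weight t ≟ n) (tables b n n) (Hπ k)) (total-tables n _ b n 0 n)

  -- A part of size t occurring with multiplicity m ≥ 1 is one forced copy of t plus m − 1 free copies;
  -- the free multiplicity stays within the bound B because a weight n ≤ B never uses B + 1 copies.
  ∑-shift-peel : ∀ t .{{_ : NonZero t}} B (φ : ℕ → ℕ → ℕ) n → n ≤ B → (∀ n′ → φ 0 n′ ≡ 0) →
                 ∑[ m < suc B ] shift (t * m) (φ m) n
                 ≡ shift t (λ n′ → ∑[ m < suc B ] shift (t * m) (φ (suc m)) n′) n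
  ∑-shift-peel t B φ n n≤B φ0≡0 = begin
    ∑[ m < suc B ] shift (t * m) (φ m) n
      ≡⟨ cong (_+ ∑< B ψ) (trans (shift-cong (t * 0) n φ0≡0) (when-zero (t * 0 ≤? n))) ⟩
    ∑< B ψ
      ≡⟨ +-identityʳ _ ⟨
    ∑< B ψ + 0
      ≡⟨ cong (∑< B ψ +_) (shift-> (φ (suc B)) (<-≤-trans (s≤s n≤B) (m≤n*m (suc B) t))) ⟨
    ∑< B ψ + ψ B
      ≡⟨ ∑<-suc B ψ ⟨
    ∑< (suc B) ψ
      ≡⟨ ∑<-cong (suc B) (λ m → cong (λ a → shift a (φ (suc m)) n) (*-suc t m)) ⟩
    ∑[ m < suc B ] shift (t + t * m) (φ (suc m)) n
      ≡⟨ ∑<-cong (suc B) (λ m → shift-shift t (t * m) (φ (suc m)) n) ⟨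
    ∑[ m < suc B ] shift t (shift (t * m) (φ (suc m))) n
      ≡⟨ ∑<-shift (suc B) t (λ m → shift (t * m) (φ (suc m))) n ⟩
    shift t (λ n′ → ∑[ m < suc B ] shift (t * m) (φ (suc m)) n′) n ∎
    where
    ψ : ℕ → ℕ
    ψ m = shift (t * suc m) (φ (suc m)) n

  count-∷-*ˡ : ∀ B t c cs n → ∑[ m < suc B ] shift (t * m) (λ n′ → c * count B cs n′) n ≡ c * count B (t ∷ cs) n
  count-∷-*ˡ B t c cs n =
    trans (∑<-cong (suc B) (λ m → shift-*ˡ (t * m) c (count B cs) n)) (∑<-*ˡ (suc B) c (λ m → shift (t * m) (count B cs) n))

  module _ (B k : ℕ) where

    presentMultiple-slot : ∀ t cs n → n ≤ B →
      ∑[ m < suc B ] shift (t * m) (λ n′ → presentMultiple k t m * count B cs n′) n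
      ≡ ifMultiple k t * shift t (count B (t ∷ cs)) n
    presentMultiple-slot zero    cs n n≤B = trans (∑<-zero (suc B) _ (λ m _ → absent m))
      (sym (cong (_* shift 0 (count B (0 ∷ cs)) n) (when-zero (k ∣? 0))))
      where
      absent : ∀ m → shift 0 (λ n′ → presentMultiple k 0 m * count B cs n′) n ≡ 0
      absent zero    = refl
      absent (suc m) = cong (λ c → c * count B cs n) (when-zero (k ∣? 0))
    presentMultiple-slot (suc t) cs n n≤B = begin
      ∑[ m < suc B ] shift (suc t * m) (λ n′ → presentMultiple k (suc t) m * count B cs n′) n
        ≡⟨ ∑-shift-peel (suc t) B (λ m n′ → presentMultiple k (suc t) m * count B cs n′) n n≤B (λ _ → refl) ⟩
      shift (suc t) (λ n′ → ∑[ m < suc B ] shift (suc t * m) (λ n″ → ifMultiple k (suc t) * count B cs n″) n′) n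
        ≡⟨ shift-cong (suc t) n (count-∷-*ˡ B (suc t) (ifMultiple k (suc t)) cs) ⟩
      shift (suc t) (λ n′ → ifMultiple k (suc t) * count B (suc t ∷ cs) n′) n
        ≡⟨ shift-*ˡ (suc t) (ifMultiple k (suc t)) (count B (suc t ∷ cs)) n ⟩
      ifMultiple k (suc t) * shift (suc t) (count B (suc t ∷ cs)) n ∎

    total-presentMultiple : ∀ cs n → n ≤ B →
      total B (presentMultiple k) cs n ≡ ∑[ s ∈ cs ] (ifMultiple k s * shift s (count B cs) n)
    total-presentMultiple []       n n≤B = refl
    total-presentMultiple (t ∷ cs) n n≤B = begin
      total B (presentMultiple k) (t ∷ cs) n
        ≡⟨ total-∷ B (presentMultiple k) t cs n ⟩
      ∑[ m < suc B ] shift (t * m) (λ n′ → presentMultiple k t m * count B cs n′) n + ∑[ m < suc B ] shift (t * m) A n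
        ≡⟨ cong₂ _+_ (presentMultiple-slot t cs n n≤B) others ⟩
      ∑[ s ∈ t ∷ cs ] (ifMultiple k s * shift s (count B (t ∷ cs)) n) ∎
      where
      A = total B (presentMultiple k) cs
      others : ∑[ m < suc B ] shift (t * m) A n ≡ ∑[ s ∈ cs ] (ifMultiple k s * shift s (count B (t ∷ cs)) n)
      others = begin
        ∑[ m < suc B ] shift (t * m) A n
          ≡⟨ ∑<-cong (suc B) (λ m → cong (when (t * m ≤? n))
               (total-presentMultiple cs (n ∸ t * m) (≤-trans (m∸n≤m n (t * m)) n≤B))) ⟩
        ∑[ m < suc B ] shift (t * m) (λ n′ → ∑[ s ∈ cs ] (ifMultiple k s * shift s (count B cs) n′)) n
          ≡⟨ ∑<-cong (suc B) (λ m → ∑∈-shift cs (t * m) (λ s n′ → ifMultiple k s * shift s (count B cs) n′) n) ⟨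
        ∑[ m < suc B ] ∑[ s ∈ cs ] shift (t * m) (λ n′ → ifMultiple k s * shift s (count B cs) n′) n
          ≡⟨ ∑<-comm-∑∈ (suc B) cs (λ m s → shift (t * m) (λ n′ → ifMultiple k s * shift s (count B cs) n′) n) ⟩
        ∑[ s ∈ cs ] ∑[ m < suc B ] shift (t * m) (λ n′ → ifMultiple k s * shift s (count B cs) n′) n
          ≡⟨ ∑∈-cong cs (λ s → trans (∑<-cong (suc B) (λ m → shift-*ˡ (t * m) (ifMultiple k s) (shift s (count B cs)) n))
                                     (∑<-*ˡ (suc B) (ifMultiple k s) (λ m → shift (t * m) (shift s (count B cs)) n))) ⟩
        ∑[ s ∈ cs ] (ifMultiple k s * ∑[ m < suc B ] shift (t * m) (shift s (count B cs)) n)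
          ≡⟨ ∑∈-cong cs (λ s → cong (ifMultiple k s *_) (trans
               (∑<-cong (suc B) (λ m → shift-comm (t * m) s (count B cs) n))
               (∑<-shift (suc B) s (λ m → shift (t * m) (count B cs)) n))) ⟩
        ∑[ s ∈ cs ] (ifMultiple k s * shift s (count B (t ∷ cs)) n) ∎

  occurrences : ℕ → List ℕ → ℕ
  occurrences k cs = ∑[ s ∈ cs ] when (s ≟ k) 1

  module _ (B k : ℕ) .{{_ : NonZero k}} where

    slotPart : ℕ → List ℕ → ℕ → ℕ
    slotPart t cs n = ∑[ m < suc B ] shift (t * m) (λ n′ → kMultiplicity k t m * count B cs n′) n

    kMultiplicity-slot : ∀ t cs n → n ≤ B →
      slotPart t cs n ≡ shift k (λ n′ → when (t ≟ k) 1 * count B (t ∷ cs) n′ + slotPart t cs n′) n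
    kMultiplicity-slot t cs n n≤B with t ≟ k
    ... | no t≢k = trans (vanish n) (sym (trans
            (shift-cong k n (λ n′ → cong₂ _+_ (cong (_* count B (t ∷ cs) n′) (when-no (t ≟ k) 1 t≢k)) (vanish n′)))
            (when-zero (k ≤? n))))
      where
      vanish : ∀ n′ → slotPart t cs n′ ≡ 0
      vanish n′ = ∑<-zero (suc B) _ (λ m _ → trans
        (shift-cong (t * m) n′ (λ n″ → cong (_* count B cs n″) (when-no (t ≟ k) m t≢k)))
        (when-zero (t * m ≤? n′)))
    ... | yes refl = begin
      slotPart k cs n
        ≡⟨ ∑<-cong (suc B) (λ m → shift-cong (k * m) n (λ n′ → cong (_* count B cs n′) (multiplicity m))) ⟩
      ∑[ m < suc B ] shift (k * m) (λ n′ → m * count B cs n′) n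
        ≡⟨ ∑-shift-peel k B (λ m n′ → m * count B cs n′) n n≤B (λ _ → refl) ⟩
      shift k (λ n′ → ∑[ m < suc B ] shift (k * m) (λ n″ → count B cs n″ + m * count B cs n″) n′) n
        ≡⟨ shift-cong k n (λ n′ → trans
             (∑<-cong (suc B) (λ m → shift-+ (k * m) (count B cs) (λ n″ → m * count B cs n″) n′))
             (∑<-+ (suc B) (λ m → shift (k * m) (count B cs) n′) (λ m → shift (k * m) (λ n″ → m * count B cs n″) n′))) ⟩
      shift k (λ n′ → count B (k ∷ cs) n′ + ∑[ m < suc B ] shift (k * m) (λ n″ → m * count B cs n″) n′) n
        ≡⟨ shift-cong k n (λ n′ → cong₂ _+_
             (trans (cong (_* count B (k ∷ cs) n′) (multiplicity 1)) (*-identityˡ (count B (k ∷ cs) n′)))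
             (∑<-cong (suc B) (λ m → shift-cong (k * m) n′ (λ n″ → cong (_* count B cs n″) (multiplicity m))))) ⟨
      shift k (λ n′ → when (k ≟ k) 1 * count B (k ∷ cs) n′ + slotPart k cs n′) n ∎
      where
      multiplicity : ∀ m → kMultiplicity k k m ≡ m
      multiplicity m = when-yes (k ≟ k) m refl

    total-kMultiplicity : ∀ cs n → n ≤ B →
      total B (kMultiplicity k) cs n
      ≡ shift k (λ n′ → occurrences k cs * count B cs n′ + total B (kMultiplicity k) cs n′) n
    total-kMultiplicity []       n n≤B = sym (when-zero (k ≤? n))
    total-kMultiplicity (t ∷ cs) n n≤B = begin
      total B (kMultiplicity k) (t ∷ cs) n
        ≡⟨ total-∷ B (kMultiplicity k) t cs n ⟩
      slotPart t cs n + restPart n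
        ≡⟨ cong₂ _+_ (kMultiplicity-slot t cs n n≤B) rest-step ⟩
      shift k (λ n′ → c * C′ n′ + slotPart t cs n′) n + shift k (λ n′ → o * C′ n′ + restPart n′) n
        ≡⟨ shift-+ k (λ n′ → c * C′ n′ + slotPart t cs n′) (λ n′ → o * C′ n′ + restPart n′) n ⟨
      shift k (λ n′ → (c * C′ n′ + slotPart t cs n′) + (o * C′ n′ + restPart n′)) n
        ≡⟨ shift-cong k n (λ n′ → trans (interchange (c * C′ n′) (slotPart t cs n′) (o * C′ n′) (restPart n′))
             (cong₂ _+_ (sym (*-distribʳ-+ (C′ n′) c o)) (sym (total-∷ B (kMultiplicity k) t cs n′)))) ⟩
      shift k (λ n′ → occurrences k (t ∷ cs) * C′ n′ + total B (kMultiplicity k) (t ∷ cs) n′) n ∎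
      where
      c = when (t ≟ k) 1
      o = occurrences k cs
      C′ = count B (t ∷ cs)
      A = total B (kMultiplicity k) cs
      restPart : ℕ → ℕ
      restPart n′ = ∑[ m < suc B ] shift (t * m) A n′
      rest-step : restPart n ≡ shift k (λ n′ → o * C′ n′ + restPart n′) n
      rest-step = begin
        ∑[ m < suc B ] shift (t * m) A n
          ≡⟨ ∑<-cong (suc B) (λ m → cong (when (t * m ≤? n))
               (total-kMultiplicity cs (n ∸ t * m) (≤-trans (m∸n≤m n (t * m)) n≤B))) ⟩
        ∑[ m < suc B ] shift (t * m) (shift k (λ n′ → o * count B cs n′ + A n′)) n
          ≡⟨ ∑<-cong (suc B) (λ m → shift-comm (t * m) k (λ n′ → o * count B cs n′ + A n′) n) ⟩
        ∑[ m < suc B ] shift k (shift (t * m) (λ n′ → o * count B cs n′ + A n′)) n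
          ≡⟨ ∑<-shift (suc B) k (λ m → shift (t * m) (λ n′ → o * count B cs n′ + A n′)) n ⟩
        shift k (λ n′ → ∑[ m < suc B ] shift (t * m) (λ n″ → o * count B cs n″ + A n″) n′) n
          ≡⟨ shift-cong k n (λ n′ → trans
               (∑<-cong (suc B) (λ m → shift-+ (t * m) (λ n″ → o * count B cs n″) A n′))
               (trans (∑<-+ (suc B) (λ m → shift (t * m) (λ n″ → o * count B cs n″) n′) (λ m → shift (t * m) A n′))
                      (cong (_+ restPart n′) (count-∷-*ˡ B t o cs n′)))) ⟩
        shift k (λ n′ → o * C′ n′ + restPart n′) n ∎

  ∑∈-colouredParts : ∀ b s off (f : ℕ → ℕ) → ∑∈ (colouredParts b s off) f ≡ b * ∑[ i < s ] f (suc (off + i))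
  ∑∈-colouredParts b zero    off f = sym (*-zeroʳ b)
  ∑∈-colouredParts b (suc s) off f = begin
    ∑∈ (replicate b (suc off) ++ colouredParts b s (suc off)) f
      ≡⟨ ∑∈-++ (replicate b (suc off)) (colouredParts b s (suc off)) f ⟩
    ∑∈ (replicate b (suc off)) f + ∑∈ (colouredParts b s (suc off)) f
      ≡⟨ cong₂ _+_ (∑∈-replicate b (suc off) f) (∑∈-colouredParts b s (suc off) f) ⟩
    b * f (suc off) + b * ∑[ i < s ] f (suc (suc off + i))
      ≡⟨ cong₂ (λ x y → b * f (suc x) + b * y) (sym (+-identityʳ off)) (∑<-cong s (λ i → cong (f ∘ suc) (sym (+-suc off i)))) ⟩
    b * f (suc (off + 0)) + b * ∑[ i < s ] f (suc (off + suc i))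
      ≡⟨ *-distribˡ-+ b _ _ ⟨
    b * ∑[ i < suc s ] f (suc (off + i)) ∎

  occurrences-colouredParts : ∀ b N k .{{_ : NonZero k}} → k ≤ N → occurrences k (colouredParts b N 0) ≡ b
  occurrences-colouredParts b N (suc k) k<N = begin
    occurrences (suc k) (colouredParts b N 0)   ≡⟨ ∑∈-colouredParts b N 0 (λ s → when (s ≟ suc k) 1) ⟩
    b * ∑[ i < N ] when (i ≟ k) 1               ≡⟨ cong (b *_) (∑<-when-≟ N k 1 k<N) ⟩
    b * 1                                       ≡⟨ *-identityʳ b ⟩
    b                                           ∎

  colouredParts-+ : ∀ b s t off → colouredParts b (s + t) off ≡ colouredParts b s off ++ colouredParts b t (s + off)
  colouredParts-+ b zero    t off = refl
  colouredParts-+ b (suc s) t off = begin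
    replicate b (suc off) ++ colouredParts b (s + t) (suc off)
      ≡⟨ cong (replicate b (suc off) ++_) (colouredParts-+ b s t (suc off)) ⟩
    replicate b (suc off) ++ (colouredParts b s (suc off) ++ colouredParts b t (s + suc off))
      ≡⟨ cong (λ o → replicate b (suc off) ++ (colouredParts b s (suc off) ++ colouredParts b t o)) (+-suc s off) ⟩
    replicate b (suc off) ++ (colouredParts b s (suc off) ++ colouredParts b t (suc s + off))
      ≡⟨ ++-assoc (replicate b (suc off)) _ _ ⟨
    colouredParts b (suc s) off ++ colouredParts b t (suc s + off) ∎

  colouredParts-> : ∀ b s off → All (off <_) (colouredParts b s off)
  colouredParts-> b zero    off = []
  colouredParts-> b (suc s) off =
    ++⁺ (replicate⁺ b ≤-refl) (All.map (<-trans (n<1+n off)) (colouredParts-> b s (suc off)))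

  ∑-shift-large : ∀ B d (f : ℕ → ℕ) y → y < d → ∑[ m < suc B ] shift (d * m) f y ≡ f y
  ∑-shift-large B d f y y<d = begin
    shift (d * 0) f y + ∑[ m < B ] shift (d * suc m) f y
      ≡⟨ cong₂ _+_ (cong (λ a → shift a f y) (*-zeroʳ d))
                   (∑<-zero B _ (λ m _ → shift-> f (<-≤-trans y<d (m≤m*n d (suc m))))) ⟩
    f y + 0
      ≡⟨ +-identityʳ (f y) ⟩
    f y ∎

  count-++-large : ∀ B cs ds y → All (y <_) ds → count B (cs ++ ds) y ≡ count B cs y
  count-++-large B []       []       y []             = refl
  count-++-large B []       (d ∷ ds) y (y<d ∷ y<ds) =
    trans (∑-shift-large B d (count B ds) y y<d) (count-++-large B [] ds y y<ds)
  count-++-large B (c ∷ cs) ds y y<ds = ∑<-cong (suc B) λ m →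
    cong (when (c * m ≤? y)) (count-++-large B cs ds (y ∸ c * m) (All.map (≤-<-trans (m∸n≤m y (c * m))) y<ds))

  count-bound-irrelevant : ∀ B B′ cs y → All (0 <_) cs → y ≤ B → B ≤ B′ → count B cs y ≡ count B′ cs y
  count-bound-irrelevant B B′ []       y []         y≤B B≤B′ = refl
  count-bound-irrelevant B B′ (s ∷ cs) y (0<s ∷ ps) y≤B B≤B′ = begin
    ∑[ m < suc B ] shift (s * m) (count B cs) y
      ≡⟨ ∑<-cong (suc B) (λ m → cong (when (s * m ≤? y))
           (count-bound-irrelevant B B′ cs (y ∸ s * m) ps (≤-trans (m∸n≤m y (s * m)) y≤B) B≤B′)) ⟩
    ∑[ m < suc B ] shift (s * m) (count B′ cs) y
      ≡⟨ ∑<-extend (suc B) (suc B′) (λ m → shift (s * m) (count B′ cs) y) (s≤s B≤B′)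
           (λ m B<m → shift-> (count B′ cs) (<-≤-trans (s≤s y≤B) (≤-trans B<m (m≤n*m m s {{>-nonZero 0<s}})))) ⟨
    ∑[ m < suc B′ ] shift (s * m) (count B′ cs) y ∎

  count-colouredParts-stable : ∀ b {M N} y → y ≤ M → M ≤ N →
    count N (colouredParts b N 0) y ≡ count M (colouredParts b M 0) y
  count-colouredParts-stable b {M} {N} y y≤M M≤N = begin
    count N (colouredParts b N 0) y
      ≡⟨ cong (λ s → count N (colouredParts b s 0) y) (m+[n∸m]≡n M≤N) ⟨
    count N (colouredParts b (M + (N ∸ M)) 0) y
      ≡⟨ cong (λ cs → count N cs y) (colouredParts-+ b M (N ∸ M) 0) ⟩
    count N (colouredParts b M 0 ++ colouredParts b (N ∸ M) (M + 0)) y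
      ≡⟨ count-++-large N (colouredParts b M 0) _ y
           (All.map (λ M+0<d → ≤-<-trans y≤M (subst (_< _) (+-identityʳ M) M+0<d))
                    (colouredParts-> b (N ∸ M) (M + 0))) ⟩
    count N (colouredParts b M 0) y
      ≡⟨ count-bound-irrelevant M N (colouredParts b M 0) y (colouredParts-> b M 0) y≤M M≤N ⟨
    count M (colouredParts b M 0) y ∎

  conv : (ℕ → ℕ) → (ℕ → ℕ) → ℕ → ℕ
  conv g q x = ∑[ i < x ] (g (suc i) * q (x ∸ suc i))

  conv-congˡ : ∀ {g g′} q x → (∀ s → g s ≡ g′ s) → conv g q x ≡ conv g′ q x
  conv-congˡ q x g≗g′ = ∑<-cong x (λ i → cong (_* q (x ∸ suc i)) (g≗g′ (suc i)))

  conv-congʳ : ∀ g {q q′} x → (∀ y → y ≤ x → q y ≡ q′ y) → conv g q x ≡ conv g q′ x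
  conv-congʳ g x q≗q′ = ∑<-cong-< x (λ i _ → cong (g (suc i) *_) (q≗q′ (x ∸ suc i) (m∸n≤m x (suc i))))

  conv-+ : ∀ g h q x → conv (λ s → g s + h s) q x ≡ conv g q x + conv h q x
  conv-+ g h q x = trans (∑<-cong x (λ i → *-distribʳ-+ (q (x ∸ suc i)) (g (suc i)) (h (suc i))))
                         (∑<-+ x (λ i → g (suc i) * q (x ∸ suc i)) (λ i → h (suc i) * q (x ∸ suc i)))

  conv-*ˡ : ∀ c g q x → conv (λ s → c * g s) q x ≡ c * conv g q x
  conv-*ˡ c g q x = trans (∑<-cong x (λ i → *-assoc c (g (suc i)) (q (x ∸ suc i))))
                          (∑<-*ˡ x c (λ i → g (suc i) * q (x ∸ suc i)))

  conv-below : ∀ g q k x → x < k → (∀ s → 0 < s → s < k → g s ≡ 0) → conv g q x ≡ 0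
  conv-below g q k x x<k g≡0 =
    ∑<-zero x _ (λ i i<x → cong (_* q (x ∸ suc i)) (g≡0 (suc i) (s≤s z≤n) (<-≤-trans (s≤s i<x) x<k)))

  conv-+-peel : ∀ g q k .{{_ : NonZero k}} y → (∀ s → 0 < s → s < k → g s ≡ 0) →
                 conv g q (k + y) ≡ g k * q y + conv (λ s → g (k + s)) q y
  conv-+-peel g q k@(suc k′) y g≡0 = begin
    conv g q (k + y)
      ≡⟨ ∑<-split k y (λ i → g (suc i) * q (k + y ∸ suc i)) ⟩
    ∑[ i < k ] (g (suc i) * q (k + y ∸ suc i)) + ∑[ j < y ] (g (suc (k + j)) * q (k + y ∸ suc (k + j)))
      ≡⟨ cong₂ _+_ (∑<-suc k′ (λ i → g (suc i) * q (k + y ∸ suc i))) (∑<-cong y (λ j → cong₂ _*_ (cong g (sym (+-suc k j)))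
                                                      (cong q (trans (cong (k + y ∸_) (sym (+-suc k j))) ([m+n]∸[m+o]≡n∸o k y (suc j)))))) ⟩
    ∑[ i < k′ ] (g (suc i) * q (k + y ∸ suc i)) + g k * q (k + y ∸ k) + conv (λ s → g (k + s)) q y
      ≡⟨ cong (λ z → z + g k * q (k + y ∸ k) + conv (λ s → g (k + s)) q y)
              (∑<-zero k′ _ (λ i i<k′ → cong (_* q (k + y ∸ suc i)) (g≡0 (suc i) (s≤s z≤n) (s≤s i<k′)))) ⟩
    g k * q (k + y ∸ k) + conv (λ s → g (k + s)) q y
      ≡⟨ cong (λ z → g k * q z + conv (λ s → g (k + s)) q y) (m+n∸m≡n k y) ⟩
    g k * q y + conv (λ s → g (k + s)) q y ∎

  module _ (k : ℕ) .{{_ : NonZero k}} where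

    multiple-below : ∀ x s → 0 < s → s < k → when (k ∣? s) x ≡ 0
    multiple-below x s@(suc _) _ s<k = when-no (k ∣? s) x (>⇒∤ s<k)

    multiple-self : ∀ x → when (k ∣? k) x ≡ x
    multiple-self x = when-yes (k ∣? k) x ∣-refl

    multiple-+ : ∀ s x → when (k ∣? k + s) x ≡ when (k ∣? s) x
    multiple-+ s x = when-⇔ (k ∣? k + s) (k ∣? s) x (λ k∣k+s → ∣m+n∣m⇒∣n k∣k+s ∣-refl) (∣m∣n⇒∣m+n ∣-refl)

    module _ (q : ℕ → ℕ) where

      isMultiple-conv-+ : ∀ y → conv (isMultiple k) q (k + y) ≡ q y + conv (isMultiple k) q y
      isMultiple-conv-+ y = begin
        conv (isMultiple k) q (k + y)
          ≡⟨ conv-+-peel (isMultiple k) q k y (λ s → multiple-below 1 s) ⟩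
        isMultiple k k * q y + conv (λ s → isMultiple k (k + s)) q y
          ≡⟨ cong₂ _+_ (trans (cong (_* q y) (multiple-self 1)) (*-identityˡ (q y)))
                       (conv-congˡ q y (λ s → multiple-+ s 1)) ⟩
        q y + conv (isMultiple k) q y ∎

      ifMultiple-conv-+ : ∀ y → conv (ifMultiple k) q (k + y) ≡ k * conv (isMultiple k) q (k + y) + conv (ifMultiple k) q y
      ifMultiple-conv-+ y = begin
        conv (ifMultiple k) q (k + y)
          ≡⟨ conv-+-peel (ifMultiple k) q k y (λ s → multiple-below s s) ⟩
        ifMultiple k k * q y + conv (λ s → ifMultiple k (k + s)) q y
          ≡⟨ cong₂ _+_ (cong (_* q y) (multiple-self k))
                       (conv-congˡ q y (λ s → trans (multiple-+ s (k + s)) (when-affine (k ∣? s) k s))) ⟩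
        k * q y + conv (λ s → k * isMultiple k s + ifMultiple k s) q y
          ≡⟨ cong (k * q y +_) (trans (conv-+ (λ s → k * isMultiple k s) (ifMultiple k) q y)
                                      (cong (_+ conv (ifMultiple k) q y) (conv-*ˡ k (isMultiple k) q y))) ⟩
        k * q y + (k * conv (isMultiple k) q y + conv (ifMultiple k) q y)
          ≡⟨ +-assoc (k * q y) _ _ ⟨
        k * q y + k * conv (isMultiple k) q y + conv (ifMultiple k) q y
          ≡⟨ cong (_+ conv (ifMultiple k) q y) (trans (cong (k *_) (isMultiple-conv-+ y)) (*-distribˡ-+ k (q y) _)) ⟨
        k * conv (isMultiple k) q (k + y) + conv (ifMultiple k) q y ∎

      isMultiple-conv : ∀ x → conv (isMultiple k) q x ≡ shift k (λ y → q y + conv (isMultiple k) q y) x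
      isMultiple-conv x with k ≤? x
      ... | yes k≤x = begin
        conv (isMultiple k) q x                     ≡⟨ cong (conv (isMultiple k) q) (m+[n∸m]≡n k≤x) ⟨
        conv (isMultiple k) q (k + (x ∸ k))         ≡⟨ isMultiple-conv-+ (x ∸ k) ⟩
        q (x ∸ k) + conv (isMultiple k) q (x ∸ k)   ≡⟨ shift-≤ (λ y → q y + conv (isMultiple k) q y) k≤x ⟨
        shift k (λ y → q y + conv (isMultiple k) q y) x ∎
      ... | no k≰x = trans (conv-below (isMultiple k) q k x (≰⇒> k≰x) (λ s → multiple-below 1 s))
                           (sym (shift-> (λ y → q y + conv (isMultiple k) q y) (≰⇒> k≰x)))

      ifMultiple-conv : ∀ x → conv (ifMultiple k) q x ≡ k * conv (isMultiple k) q x + conv (ifMultiple k) q (x ∸ k)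
      ifMultiple-conv x with k ≤? x
      ... | yes k≤x = begin
        conv (ifMultiple k) q x
          ≡⟨ cong (conv (ifMultiple k) q) (m+[n∸m]≡n k≤x) ⟨
        conv (ifMultiple k) q (k + (x ∸ k))
          ≡⟨ ifMultiple-conv-+ (x ∸ k) ⟩
        k * conv (isMultiple k) q (k + (x ∸ k)) + conv (ifMultiple k) q (x ∸ k)
          ≡⟨ cong (λ z → k * conv (isMultiple k) q z + conv (ifMultiple k) q (x ∸ k)) (m+[n∸m]≡n k≤x) ⟩
        k * conv (isMultiple k) q x + conv (ifMultiple k) q (x ∸ k) ∎
      ... | no k≰x = begin
        conv (ifMultiple k) q x                     ≡⟨ conv-below (ifMultiple k) q k x x<k (λ s → multiple-below s s) ⟩
        0                                           ≡⟨ *-zeroʳ k ⟨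
        k * 0                                       ≡⟨ +-identityʳ (k * 0) ⟨
        k * 0 + conv (ifMultiple k) q 0             ≡⟨ cong₂ (λ a b → k * a + conv (ifMultiple k) q b)
                                                             (conv-below (isMultiple k) q k x x<k (λ s → multiple-below 1 s))
                                                             (m≤n⇒m∸n≡0 (<⇒≤ x<k)) ⟨
        k * conv (isMultiple k) q x + conv (ifMultiple k) q (x ∸ k) ∎
        where x<k = ≰⇒> k≰x

  module _ (b : ℕ) where

    partitions : ℕ → ℕ → ℕ
    partitions N = count N (colouredParts b N 0)

    H-conv : ∀ k n → H b k n ≡ b * conv (ifMultiple k) (partitions n) n
    H-conv k n = begin
      H b k n
        ≡⟨ H-total b k n ⟩
      total n (presentMultiple k) (colouredParts b n 0) n
        ≡⟨ total-presentMultiple n k (colouredParts b n 0) n ≤-refl ⟩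
      ∑[ s ∈ colouredParts b n 0 ] (ifMultiple k s * shift s (partitions n) n)
        ≡⟨ ∑∈-colouredParts b n 0 (λ s → ifMultiple k s * shift s (partitions n) n) ⟩
      b * ∑[ i < n ] (ifMultiple k (suc i) * shift (suc i) (partitions n) n)
        ≡⟨ cong (b *_) (∑<-cong-< n (λ i i<n → cong (ifMultiple k (suc i) *_) (shift-≤ (partitions n) i<n))) ⟩
      b * conv (ifMultiple k) (partitions n) n ∎

    module _ (k : ℕ) .{{_ : NonZero k}} where

      total-kMultiplicity-conv : ∀ N x → x ≤ N →
        total N (kMultiplicity k) (colouredParts b N 0) x ≡ b * conv (isMultiple k) (partitions N) x
      total-kMultiplicity-conv N = <-rec _ step
        where
        T : ℕ → ℕ
        T = total N (kMultiplicity k) (colouredParts b N 0)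
        C : ℕ → ℕ
        C = conv (isMultiple k) (partitions N)
        step : ∀ x → (∀ {y} → y < x → y ≤ N → T y ≡ b * C y) → x ≤ N → T x ≡ b * C x
        step x rec x≤N with k ≤? x
        ... | yes k≤x = begin
          T x
            ≡⟨ total-kMultiplicity N k (colouredParts b N 0) x x≤N ⟩
          shift k (λ y → occurrences k (colouredParts b N 0) * partitions N y + T y) x
            ≡⟨ shift-≤ (λ y → occurrences k (colouredParts b N 0) * partitions N y + T y) k≤x ⟩
          occurrences k (colouredParts b N 0) * partitions N (x ∸ k) + T (x ∸ k)
            ≡⟨ cong₂ _+_ (cong (_* partitions N (x ∸ k)) (occurrences-colouredParts b N k (≤-trans k≤x x≤N)))
                         (rec (∸-monoʳ-< (>-nonZero⁻¹ k) k≤x) (≤-trans (m∸n≤m x k) x≤N)) ⟩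
          b * partitions N (x ∸ k) + b * C (x ∸ k)
            ≡⟨ *-distribˡ-+ b _ _ ⟨
          b * (partitions N (x ∸ k) + C (x ∸ k))
            ≡⟨ cong (b *_) (trans (isMultiple-conv k (partitions N) x) (shift-≤ (λ y → partitions N y + C y) k≤x)) ⟨
          b * C x ∎
        ... | no k≰x = begin
          T x       ≡⟨ total-kMultiplicity N k (colouredParts b N 0) x x≤N ⟩
          shift k (λ y → occurrences k (colouredParts b N 0) * partitions N y + T y) x
                    ≡⟨ shift-> (λ y → occurrences k (colouredParts b N 0) * partitions N y + T y) (≰⇒> k≰x) ⟩
          0         ≡⟨ *-zeroʳ b ⟨
          b * 0     ≡⟨ cong (b *_) (trans (isMultiple-conv k (partitions N) x) (shift-> (λ y → partitions N y + C y) (≰⇒> k≰x))) ⟨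
          b * C x   ∎

      F-conv : ∀ n → F b k n ≡ b * conv (isMultiple k) (partitions n) n
      F-conv n = trans (F-total b k n) (total-kMultiplicity-conv n n ≤-refl)

      H-recurrence : ∀ n → H b k n ≡ k * F b k n + H b k (n ∸ k)
      H-recurrence n = begin
        H b k n
          ≡⟨ H-conv k n ⟩
        b * conv (ifMultiple k) (partitions n) n
          ≡⟨ cong (b *_) (ifMultiple-conv k (partitions n) n) ⟩
        b * (k * conv (isMultiple k) (partitions n) n + conv (ifMultiple k) (partitions n) (n ∸ k))
          ≡⟨ trans (*-distribˡ-+ b _ _) (cong (_+ b * conv (ifMultiple k) (partitions n) (n ∸ k)) (x∙yz≈y∙xz b k _)) ⟩
        k * (b * conv (isMultiple k) (partitions n) n) + b * conv (ifMultiple k) (partitions n) (n ∸ k)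
          ≡⟨ cong₂ (λ f h → k * f + b * h) (sym (F-conv n))
               (conv-congʳ (ifMultiple k) (n ∸ k) (λ y y≤n∸k → count-colouredParts-stable b y y≤n∸k (m∸n≤m n k))) ⟩
        k * F b k n + b * conv (ifMultiple k) (partitions (n ∸ k)) (n ∸ k)
          ≡⟨ cong (k * F b k n +_) (H-conv k (n ∸ k)) ⟨
        k * F b k n + H b k (n ∸ k) ∎

open Recurrence using (H-recurrence)
open import Data.Nat as ℕ using (ℕ; suc; _≥_; _<_; _∸_; _≤?_; >-nonZero)
open import Data.Nat.Properties as ℕ using (≰⇒>; <⇒≤; m<n⇒0<n∸m; m≤n⇒m∸n≡0; m≤n+m; m+n∸n≡m)
open import Data.Integer as ℤ using (+_; _-_; _*_)
import Data.Integer.Properties as ℤ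
open import Relation.Nullary using (yes; no)
open import Relation.Binary.PropositionalEquality using (_≡_; refl; cong; cong₂; trans; module ≡-Reasoning)
open ≡-Reasoning

Hℤ-∸ : ∀ b k n → Hℤ b k (+ n - + k) ≡ H b k (n ∸ k)
Hℤ-∸ b k n with k ≤? n
... | yes k≤n = cong (Hℤ b k) (trans (ℤ.m-n≡m⊖n n k) (ℤ.⊖-≥ k≤n))
... | no k≰n = begin
  Hℤ b k (+ n - + k)          ≡⟨ cong (Hℤ b k) (trans (ℤ.m-n≡m⊖n n k) (ℤ.⊖-< n<k)) ⟩
  Hℤ b k (ℤ.- (+ (k ∸ n)))    ≡⟨ negative (k ∸ n) (m<n⇒0<n∸m n<k) ⟩
  0                           ≡⟨⟩   -- the only partition of 0 is the empty one
  H b k 0                     ≡⟨ cong (H b k) (m≤n⇒m∸n≡0 (<⇒≤ n<k)) ⟨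
  H b k (n ∸ k)               ∎
  where
  n<k = ≰⇒> k≰n
  negative : ∀ m → 0 < m → Hℤ b k (ℤ.- (+ m)) ≡ 0
  negative (suc m) _ = refl

+[m+n]-+n≡+m : ∀ m n → + (m ℕ.+ n) - + n ≡ + m
+[m+n]-+n≡+m m n = trans (ℤ.m-n≡m⊖n (m ℕ.+ n) n) (trans (ℤ.⊖-≥ (m≤n+m n m)) (cong +_ (m+n∸n≡m m n)))

theorem3 : (b k n : ℕ) → b ≥ 1 → k ≥ 1 → n ≥ 1 →
    (+ k) * (+ F b k n) ≡ (+ H b k n) - (+ Hℤ b k ((+ n) - (+ k)))
theorem3 b k n _ k≥1 _ = begin
  + k * + F b k n                               ≡⟨ ℤ.pos-* k (F b k n) ⟨
  + (k ℕ.* F b k n)                             ≡⟨ +[m+n]-+n≡+m (k ℕ.* F b k n) (H b k (n ∸ k)) ⟨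
  + (k ℕ.* F b k n ℕ.+ H b k (n ∸ k)) - + H b k (n ∸ k)
    ≡⟨ cong₂ (λ h h′ → + h - + h′) (H-recurrence b k {{>-nonZero k≥1}} n) (Hℤ-∸ b k n) ⟨
  + H b k n - + Hℤ b k (+ n - + k)              ∎
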